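{- The mapping $\Phi$, defined on the set of rooted unicellular maps with three distinguished (unordered) distinct vertices and sending $(\mathfrak{m},\{v_1,v_2,v_3\})$ to $(\bar{\mathfrak{m}},\tau)$, is injective.
   Context: A unicellular map with $n$ edges is a triple $\mathfrak{m}=(H,\alpha,\sigma)$ with $|H|=2n$, $\alpha$ a fixed-point-free involution of $H$, $\sigma$ a permutation of $H$ such that $\gamma=\alpha\sigma$ ($\gamma(h)=\alpha(\sigma(h))$) is a single cycle; the cycles of $\sigma$ are the vertices. Maps are rooted at a half-edge $r$, and two rooted maps are identified if some bijection of half-edge sets maps root to root and conjugates $\alpha$ and $\sigma$ to their counterparts. The total order $<_{\mathfrak{m}}$ on $H$ is $r<_{\mathfrak{m}}\gamma(r)<_{\mathfrak{m}}\dots<_{\mathfrak{m}}\gamma^{2n-1}(r)$; $\min_{\mathfrak{m}}(v)$ is the minimal half-edge of a vertex $v$. Gluing: given half-edges $a_1<_{\mathfrak{m}}a_2<_{\mathfrak{m}}a_3$ in three distinct vertices $v_i=(a_i,h_i^1,\dots,h_i^{m_i})$, the glued map is $(H,\alpha,\bar\sigma)$ (same root), where $\bar\sigma$ is obtained from $\sigma$ by replacing $v_1,v_2,v_3$ with the single cycle $(a_1,h_2^1,\dots,h_2^{m_2},a_2,h_3^1,\dots,h_3^{m_3},a_3,h_1^1,\dots,h_1^{m_1})$. The map $\Phi$: given three distinct vertices of $\mathfrak{m}$, name them $v_1,v_2,v_3$ so that $a_i=\min_{\mathfrak{m}}v_i$ satisfy $a_1<_{\mathfrak{m}}a_2<_{\mathfrak{m}}a_3$;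 let $\bar{\mathfrak{m}}=(H,\alpha,\bar\sigma)$ be the gluing of $\mathfrak{m}$ at $a_1,a_2,a_3$, and $\tau=\bar\sigma^{ -1}(a_3)$. Then $\Phi(\mathfrak{m},\{v_1,v_2,v_3\})=(\bar{\mathfrak{m}},\tau)$. -}

module Defs where

open import Data.Nat using (ℕ; zero; suc; _*_; _<_)
open import Data.Fin using (Fin; _≟_)
open import Data.Fin.Permutation using (Permutation′; _⟨$⟩ʳ_)
open import Data.Product using (Σ; ∃; ∃₂; _×_; _,_)
open import Data.Sum using (_⊎_)
open import Relation.Binary.PropositionalEquality using (_≡_)
open import Relation.Nullary using (¬_; yes; no)

iter : ∀ {A : Set} → (A → A) → ℕ → A → A
iter f zero    x = x
iter f (suc k) x = f (iter f k x)

-- A rooted unicellular map with n edges on the half-edge set H = Fin (2 n).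
-- (Fixing the carrier Fin (2n) loses nothing: maps are only considered up to
-- root-preserving relabelling of half-edges.)
record UMap (n : ℕ) : Set where
  field
    α    : Permutation′ (2 * n)
    σ    : Permutation′ (2 * n)
    root : Fin (2 * n)
    α-invol : ∀ h → α ⟨$⟩ʳ (α ⟨$⟩ʳ h) ≡ h
    α-fpf   : ∀ h → ¬ (α ⟨$⟩ʳ h ≡ h)
    -- γ = α σ is a single cycle: γ acts transitively on H
    γ-one-cycle : ∀ h h' → ∃ λ k → iter (λ x → α ⟨$⟩ʳ (σ ⟨$⟩ʳ x)) k h ≡ h'

module _ {n : ℕ} (m : UMap n) where
  open UMap m

  H : Set
  H = Fin (2 * n)

  γ : H → H
  γ x = α ⟨$⟩ʳ (σ ⟨$⟩ʳ x)

  SameVertex : H → H → Set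
  SameVertex h h' = ∃ λ k → iter (σ ⟨$⟩ʳ_) k h ≡ h'

  _<ₘ_ : H → H → Set
  h <ₘ h' = ∃₂ λ k k' → k < k' × k' < 2 * n × iter γ k root ≡ h × iter γ k' root ≡ h'

  IsMinOfVertex : H → H → Set
  IsMinOfVertex v a = SameVertex v a × (∀ h → SameVertex v h → h ≡ a ⊎ a <ₘ h)

  DistinctVertices : (Fin 3 → H) → Set
  DistinctVertices v = ∀ i j → SameVertex (v i) (v j) → i ≡ j

-- the gluing: σ̄ obtained from σ by replacing the cycles of a₁,a₂,a₃ by
-- (a₁,h₂¹..h₂^{m₂},a₂,h₃¹..h₃^{m₃},a₃,h₁¹..h₁^{m₁}); written pointwise:
-- σ̄ a₁ = σ a₂, σ̄ a₂ = σ a₃, σ̄ a₃ = σ a₁, and σ̄ h = σ h otherwise.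
glue : ∀ {N} → (Fin N → Fin N) → Fin N → Fin N → Fin N → Fin N → Fin N
glue σ a₁ a₂ a₃ h with h ≟ a₁ | h ≟ a₂ | h ≟ a₃
... | yes _ | _     | _     = σ a₂
... | no _  | yes _ | _     = σ a₃
... | no _  | no _  | yes _ = σ a₁
... | no _  | no _  | no _  = σ h

module _ {n : ℕ} (m : UMap n) where
  open UMap m

  -- Graph of Φ: Φ(m,{v 0, v 1, v 2}) = ((H, α, σ̄), τ).
  -- The vertices are renamed via π so that a i = min of vertex v (π i)
  -- and a 0 <ₘ a 1 <ₘ a 2; σ̄ is the gluing at a 0, a 1, a 2 and τ = σ̄⁻¹(a 2).
  PhiGraph : (Fin 3 → H m) → (H m → H m) → H m → Set
  PhiGraph v σ̄ τ =
    Σ (Permutation′ 3) λ π → Σ (Fin 3 → H m) λ a →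
      (∀ i → IsMinOfVertex m (v (π ⟨$⟩ʳ i)) (a i))
      × _<ₘ_ m (a Fin.zero) (a (Fin.suc Fin.zero))
      × _<ₘ_ m (a (Fin.suc Fin.zero)) (a (Fin.suc (Fin.suc Fin.zero)))
      × (∀ h → σ̄ h ≡ glue (σ ⟨$⟩ʳ_) (a Fin.zero) (a (Fin.suc Fin.zero)) (a (Fin.suc (Fin.suc Fin.zero))) h)
      × σ̄ τ ≡ a (Fin.suc (Fin.suc Fin.zero))

IsoMarked : ∀ {N} → (α σ : Fin N → Fin N) (r τ : Fin N)
          → (α' σ' : Fin N → Fin N) (r' τ' : Fin N) → Set
IsoMarked {N} α σ r τ α' σ' r' τ' =
  Σ (Permutation′ N) λ φ →
    φ ⟨$⟩ʳ r ≡ r'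
    × (∀ h → φ ⟨$⟩ʳ (α h) ≡ α' (φ ⟨$⟩ʳ h))
    × (∀ h → φ ⟨$⟩ʳ (σ h) ≡ σ' (φ ⟨$⟩ʳ h))
    × φ ⟨$⟩ʳ τ ≡ τ'

IsoWithVertices : ∀ {n} (m m' : UMap n) → (Fin 3 → H m) → (Fin 3 → H m') → Set
IsoWithVertices {n} m m' v v' =
  Σ (Permutation′ (2 * n)) λ φ →
    φ ⟨$⟩ʳ UMap.root m ≡ UMap.root m'
    × (∀ h → φ ⟨$⟩ʳ (UMap.α m ⟨$⟩ʳ h) ≡ UMap.α m' ⟨$⟩ʳ (φ ⟨$⟩ʳ h))
    × (∀ h → φ ⟨$⟩ʳ (UMap.σ m ⟨$⟩ʳ h) ≡ UMap.σ m' ⟨$⟩ʳ (φ ⟨$⟩ʳ h))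
    × (∀ i → ∃ λ j → SameVertex m' (φ ⟨$⟩ʳ v i) (v' j))
    × (∀ j → ∃ λ i → SameVertex m' (φ ⟨$⟩ʳ v i) (v' j))

module Submission where

-- Let Φ(m, {v₁,v₂,v₃}) = (m̄, τ), where m̄ glues m at the
-- vertex minima a₁ < a₂ < a₃.  We show that a₁, a₂, a₃ can be read off from
-- (m̄, τ) alone, by properties that every isomorphism of marked maps preserves:
--   * a₃ = σ̄ τ;
--   * a₁ is the first half-edge of the tour of γ̄ = α σ̄ whose σ̄-cycle contains a₃;
--   * a₂ is the first half-edge of the γ̄-tour that lies strictly between a₁ and
--     a₃ on their σ̄-cycle and comes later than a₃ in the γ̄-tour.
-- Since σ is recovered from σ̄ by ungluing at a₁, a₂, a₃, an isomorphism of the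
-- glued marked maps is then an isomorphism of the original maps which matches
-- the distinguished vertices.
--
-- The module Gluing analyses the tour of γ̄: it is the tour of γ with the stretch
-- from a₁ to a₂ exchanged with the stretch from a₂ to a₃.

open import Defs
open import Algebra.Properties.CommutativeSemigroup using (x∙yz≈y∙xz)
open import Data.Nat using (ℕ; zero; suc; _+_; _*_; _≤_; _<_; s≤s; s≤s⁻¹; _≤?_)
open import Data.Nat.Properties hiding (_≟_)
open import Data.Nat.DivMod using (_%_; _/_; m%n<n; m≡m%n+[m/n]*n)
open import Data.Fin using (Fin; toℕ; fromℕ<; _≟_)
open import Data.Fin.Patterns using (0F; 1F; 2F)
import Data.Fin.Properties as FinProps
open import Data.Fin.Permutation using (Permutation′; _⟨$⟩ʳ_; _⟨$⟩ˡ_; inverseʳ)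
open import Data.Product using (∃; _×_; _,_; proj₁; proj₂)
open import Data.Sum using (_⊎_; inj₁; inj₂)
import Data.Sum as Sum
open import Function.Bundles using (Injection)
open import Function.Properties.Inverse using (↔⇒↣)
open import Relation.Nullary using (¬_; yes; no; Dec; contradiction)
open import Relation.Binary.PropositionalEquality
open import Relation.Binary.Definitions using (tri<; tri≈; tri>)

iter-add : ∀ {A : Set} (f : A → A) i j x → iter f (i + j) x ≡ iter f i (iter f j x)
iter-add f zero    j x = refl
iter-add f (suc i) j x = cong f (iter-add f i j x)

iter-add′ : ∀ {A : Set} (f : A → A) i j x → iter f (i + j) x ≡ iter f j (iter f i x)
iter-add′ f i j x = trans (cong (λ k → iter f k x) (+-comm i j)) (iter-add f j i x)

iter-suc : ∀ {A : Set} (f : A → A) i x → iter f (suc i) x ≡ iter f i (f x)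
iter-suc f zero    x = refl
iter-suc f (suc i) x = cong f (iter-suc f i x)

iter-after : ∀ {A : Set} (f : A → A) i p x → iter f (suc i + p) x ≡ iter f i (f (iter f p x))
iter-after f i p x = trans (cong (λ k → iter f k x) (sym (+-suc i p))) (iter-add f i (suc p) x)

iter-periodic : ∀ {A : Set} (f : A → A) p x → iter f p x ≡ x → ∀ q → iter f (q * p) x ≡ x
iter-periodic f p x per zero    = refl
iter-periodic f p x per (suc q) =
  trans (iter-add f p (q * p) x) (trans (cong (iter f p) (iter-periodic f p x per q)) per)

iter-cancel : ∀ {A : Set} (f : A → A) → (∀ {x y} → f x ≡ f y → x ≡ y)
            → ∀ k {x y} → iter f k x ≡ iter f k y → x ≡ y
iter-cancel f f-inj zero    e = e
iter-cancel f f-inj (suc k) e = iter-cancel f f-inj k (f-inj e)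

iter-conj : ∀ {A B : Set} (f : A → A) (g : B → B) (φ : A → B) → (∀ h → φ (f h) ≡ g (φ h))
          → ∀ k x → φ (iter f k x) ≡ iter g k (φ x)
iter-conj f g φ conj zero    x = refl
iter-conj f g φ conj (suc k) x = trans (conj _) (cong g (iter-conj f g φ conj k x))

iter-follow : ∀ {A : Set} (f g : A → A) i x → (∀ j → j < i → f (iter g j x) ≡ g (iter g j x))
            → iter f i x ≡ iter g i x
iter-follow f g zero    x agree = refl
iter-follow f g (suc i) x agree =
  trans (cong f (iter-follow f g i x (λ j j<i → agree j (m<n⇒m<1+n j<i)))) (agree i (n<1+n i))

offset : ∀ {b k} → b < k → ∃ λ i → k ≡ suc i + b
offset {b} b<k with m≤n⇒∃[o]m+o≡n b<k
... | i , e = i , trans (sym e) (cong suc (+-comm b i))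

least : (P : ℕ → Set) → (∀ k → Dec (P k)) → ∀ n → P n → ∃ λ k → P k × (∀ j → j < k → ¬ P j)
least P P? zero    p = zero , p , λ j ()
least P P? (suc n) p with P? zero
... | yes p₀ = zero , p₀ , λ j ()
... | no ¬p₀ with least (λ k → P (suc k)) (λ k → P? (suc k)) n p
...   | k , pk , below = suc k , pk , below′
  where
  below′ : ∀ j → j < suc k → ¬ P j
  below′ zero    _         = ¬p₀
  below′ (suc j) (s≤s j<k) = below j j<k

perm-injective : ∀ {N} (π : Permutation′ N) {x y} → π ⟨$⟩ʳ x ≡ π ⟨$⟩ʳ y → x ≡ y
perm-injective π = Injection.injective (↔⇒↣ π)

module Dynamics {N : ℕ} (f : Fin N → Fin N) (f-inj : ∀ {x y} → f x ≡ f y → x ≡ y) where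

  -- Every point is periodic with period at most N (pigeonhole on x, f x, …, f^N x).
  period : ∀ x → ∃ λ d → suc d ≤ N × iter f (suc d) x ≡ x
  period x with FinProps.pigeonhole (n<1+n N) (λ (i : Fin (suc N)) → iter f (toℕ i) x)
  ... | i , j , i<j , same with offset i<j
  ...   | d , j≡ = d , bound , sym (iter-cancel f f-inj (toℕ i) shifted)
    where
    bound : suc d ≤ N
    bound = ≤-trans (m≤m+n (suc d) (toℕ i)) (subst (_≤ N) j≡ (s≤s⁻¹ (FinProps.toℕ<n j)))
    shifted : iter f (toℕ i) x ≡ iter f (toℕ i) (iter f (suc d) x)
    shifted = trans same (trans (cong (λ k → iter f k x) j≡) (iter-add′ f (suc d) (toℕ i) x))

  iter-mod : ∀ d x → iter f (suc d) x ≡ x → ∀ k → iter f (k % suc d) x ≡ iter f k x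
  iter-mod d x per k = sym (begin
    iter f k x
      ≡⟨ cong (λ j → iter f j x) (m≡m%n+[m/n]*n k (suc d)) ⟩
    iter f (k % suc d + (k / suc d) * suc d) x
      ≡⟨ iter-add f (k % suc d) _ x ⟩
    iter f (k % suc d) (iter f ((k / suc d) * suc d) x)
      ≡⟨ cong (iter f (k % suc d)) (iter-periodic f (suc d) x per (k / suc d)) ⟩
    iter f (k % suc d) x
      ∎)
    where open ≡-Reasoning

  -- Orbits are symmetric: going around the period brings y = f^k x back to x.
  orbit-symmetric : ∀ {x y} k → iter f k x ≡ y → ∃ λ j → iter f j y ≡ x
  orbit-symmetric {x} {y} k e with period x
  ... | d , _ , per = d * k , (begin
    iter f (d * k) y             ≡⟨ cong (iter f (d * k)) (sym e) ⟩
    iter f (d * k) (iter f k x)  ≡⟨ sym (iter-add f (d * k) k x) ⟩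
    iter f (d * k + k) x         ≡⟨ cong (λ j → iter f j x) (trans (+-comm (d * k) k) (*-comm (suc d) k)) ⟩
    iter f (k * suc d) x         ≡⟨ iter-periodic f (suc d) x per k ⟩
    x                            ∎)
    where open ≡-Reasoning

  first-return : ∀ x → ∃ λ c → iter f c (f x) ≡ x × (∀ j → j < c → iter f j (f x) ≢ x)
  first-return x with period x
  ... | d , _ , per =
    least (λ c → iter f c (f x) ≡ x) (λ c → iter f c (f x) ≟ x) d (trans (sym (iter-suc f d x)) per)

  module Transitive (r : Fin N) (transitive : ∀ h → ∃ λ k → iter f k r ≡ h) where

    position-exists : ∀ h → ∃ λ k → k < N × iter f k r ≡ h
    position-exists h with period r | transitive h
    ... | d , d<N , per | k , e =
      k % suc d , <-≤-trans (m%n<n k (suc d)) d<N , trans (iter-mod d r per k) e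

    residue : ∀ d → Fin N → Fin (suc d)
    residue d h = fromℕ< (m%n<n (proj₁ (transitive h)) (suc d))

    residue-position : ∀ d → iter f (suc d) r ≡ r → ∀ h → iter f (toℕ (residue d h)) r ≡ h
    residue-position d per h =
      trans (cong (λ k → iter f k r) (FinProps.toℕ-fromℕ< (m%n<n (proj₁ (transitive h)) (suc d))))
            (trans (iter-mod d r per (proj₁ (transitive h))) (proj₂ (transitive h)))

    -- A period below N would squeeze the N points onto fewer than N residues.
    no-short-period : ∀ d → suc d < N → iter f (suc d) r ≢ r
    no-short-period d d<N per with FinProps.pigeonhole d<N (residue d)
    ... | i , j , i<j , same = FinProps.<⇒≢ i<j (begin
      i                                 ≡⟨ sym (residue-position d per i) ⟩
      iter f (toℕ (residue d i)) r      ≡⟨ cong (λ z → iter f (toℕ z) r) same ⟩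
      iter f (toℕ (residue d j)) r      ≡⟨ residue-position d per j ⟩
      j                                 ∎)
      where open ≡-Reasoning

    collision-free : ∀ {i j} → i < j → j < N → iter f i r ≢ iter f j r
    collision-free {i} i<j j<N e with offset i<j
    ... | d , refl = no-short-period d (≤-<-trans (m≤m+n (suc d) i) j<N)
                       (sym (iter-cancel f f-inj i (trans e (iter-add′ f (suc d) i r))))

    position-unique : ∀ {i j} → i < N → j < N → iter f i r ≡ iter f j r → i ≡ j
    position-unique {i} {j} i<N j<N e with <-cmp i j
    ... | tri< i<j _ _ = contradiction e (collision-free i<j j<N)
    ... | tri≈ _ i≡j _ = i≡j
    ... | tri> _ _ j<i = contradiction (sym e) (collision-free j<i i<N)

σ⟨_⟩ α⟨_⟩ : ∀ {n} (m : UMap n) → H m → H m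
σ⟨ m ⟩ h = UMap.σ m ⟨$⟩ʳ h
α⟨ m ⟩ h = UMap.α m ⟨$⟩ʳ h

module _ {n} (m : UMap n) where
  open Dynamics σ⟨ m ⟩ (perm-injective (UMap.σ m)) using (orbit-symmetric)

  vertex-refl : ∀ x → SameVertex m x x
  vertex-refl x = 0 , refl

  vertex-step : ∀ x → SameVertex m x (σ⟨ m ⟩ x)
  vertex-step x = 1 , refl

  vertex-sym : ∀ {x y} → SameVertex m x y → SameVertex m y x
  vertex-sym (k , e) = orbit-symmetric k e

  vertex-trans : ∀ {x y z} → SameVertex m x y → SameVertex m y z → SameVertex m x z
  vertex-trans {x} (k , e) (k′ , e′) = k′ + k , trans (iter-add σ⟨ m ⟩ k′ k x) (trans (cong (iter σ⟨ m ⟩ k′) e) e′)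

vertex-transport : ∀ {n} (m m′ : UMap n) (φ : H m → H m′) → (∀ h → φ (σ⟨ m ⟩ h) ≡ σ⟨ m′ ⟩ (φ h))
                 → ∀ {x y} → SameVertex m x y → SameVertex m′ (φ x) (φ y)
vertex-transport m m′ φ conj {x} (k , e) = k , trans (sym (iter-conj σ⟨ m ⟩ σ⟨ m′ ⟩ φ conj k x)) (cong φ e)

module _ {N} (f : Fin N → Fin N) (a b c : Fin N) where

  glue-at₁ : glue f a b c a ≡ f b
  glue-at₁ with a ≟ a
  ... | yes _  = refl
  ... | no a≢a = contradiction refl a≢a

  glue-at₂ : b ≢ a → glue f a b c b ≡ f c
  glue-at₂ b≢a with b ≟ a | b ≟ b
  ... | yes b≡a | _      = contradiction b≡a b≢a
  ... | no _    | yes _  = refl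
  ... | no _    | no b≢b = contradiction refl b≢b

  glue-at₃ : c ≢ a → c ≢ b → glue f a b c c ≡ f a
  glue-at₃ c≢a c≢b with c ≟ a | c ≟ b | c ≟ c
  ... | yes c≡a | _       | _      = contradiction c≡a c≢a
  ... | no _    | yes c≡b | _      = contradiction c≡b c≢b
  ... | no _    | no _    | yes _  = refl
  ... | no _    | no _    | no c≢c = contradiction refl c≢c

  glue-elsewhere : ∀ h → h ≢ a → h ≢ b → h ≢ c → glue f a b c h ≡ f h
  glue-elsewhere h h≢a h≢b h≢c with h ≟ a | h ≟ b | h ≟ c
  ... | yes h≡a | _       | _       = contradiction h≡a h≢a
  ... | no _    | yes h≡b | _       = contradiction h≡b h≢b
  ... | no _    | no _    | yes h≡c = contradiction h≡c h≢c
  ... | no _    | no _    | no _    = refl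

module Unglue {N} (φ : Fin N → Fin N) (φ-inj : ∀ {x y} → φ x ≡ φ y → x ≡ y)
  (f f′ : Fin N → Fin N) {a b c a′ b′ c′ : Fin N}
  (b≢a : b ≢ a) (c≢a : c ≢ a) (c≢b : c ≢ b) (φa : φ a ≡ a′) (φb : φ b ≡ b′) (φc : φ c ≡ c′)
  (conj : ∀ h → φ (glue f a b c h) ≡ glue f′ a′ b′ c′ (φ h)) where

  private
    image-≢ : ∀ {x y x′ y′} → x ≢ y → φ x ≡ x′ → φ y ≡ y′ → x′ ≢ y′
    image-≢ x≢y φx φy e = x≢y (φ-inj (trans φx (trans e (sym φy))))

    -- the glued equation at x, read on both sides, transfers f at y
    via : ∀ {x y x′ y′} → φ x ≡ x′ → φ y ≡ y′ → glue f a b c x ≡ f y → glue f′ a′ b′ c′ x′ ≡ f′ y′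
        → φ (f y) ≡ f′ (φ y)
    via φx φy e e′ =
      trans (cong φ (sym e)) (trans (conj _) (trans (cong (glue f′ a′ b′ c′) φx) (trans e′ (cong f′ (sym φy)))))

  unglue-conj : ∀ h → φ (f h) ≡ f′ (φ h)
  unglue-conj h with h ≟ a | h ≟ b | h ≟ c
  ... | yes refl | _ | _ =
    via φc φa (glue-at₃ f a b c c≢a c≢b) (glue-at₃ f′ a′ b′ c′ (image-≢ c≢a φc φa) (image-≢ c≢b φc φb))
  ... | no _ | yes refl | _ = via φa φb (glue-at₁ f a b c) (glue-at₁ f′ a′ b′ c′)
  ... | no _ | no _ | yes refl = via φb φc (glue-at₂ f a b c b≢a) (glue-at₂ f′ a′ b′ c′ (image-≢ b≢a φb φa))
  ... | no h≢a | no h≢b | no h≢c =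
    via refl refl (glue-elsewhere f a b c h h≢a h≢b h≢c)
        (glue-elsewhere f′ a′ b′ c′ (φ h) (image-≢ h≢a refl φa) (image-≢ h≢b refl φb) (image-≢ h≢c refl φc))

module Tour {N : ℕ} (γ : Fin N → Fin N) (r : Fin N) where

  At : ℕ → Fin N → Set
  At k x = k < N × iter γ k r ≡ x

  EarliestAt : (ℕ → Fin N → Set) → ℕ → Fin N → Set
  EarliestAt Q k x = At k x × Q k x × (∀ k′ y → At k′ y → Q k′ y → k ≤ k′)

  earliest-unique : ∀ {Q k k′ x y} → EarliestAt Q k x → EarliestAt Q k′ y → x ≡ y
  earliest-unique (at-x@(_ , ex) , qx , x-first) (at-y@(_ , ey) , qy , y-first) =
    trans (sym ex) (trans (cong (λ j → iter γ j r) (≤-antisym (x-first _ _ at-y qy) (y-first _ _ at-x qx))) ey)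

module Marked {N : ℕ} (α σ̄ : Fin N → Fin N) (r : Fin N) where
  open Tour (λ h → α (σ̄ h)) r public

  FirstKey : Fin N → ℕ → Fin N → Set
  FirstKey b _ x = ∃ λ j → iter σ̄ j x ≡ b

  SecondKey : Fin N → Fin N → ℕ → Fin N → Set
  SecondKey a b k x = (∃ λ j → iter σ̄ (suc j) a ≡ x × (∀ i → i ≤ suc j → iter σ̄ i a ≢ b))
                    × (∃ λ k₀ → At k₀ b × k₀ < k)

module MarkedIso {N : ℕ} {α σ̄ α′ σ̄′ : Fin N → Fin N} {r r′ : Fin N} (φ : Permutation′ N)
  (φ-root : φ ⟨$⟩ʳ r ≡ r′) (φ-α : ∀ h → φ ⟨$⟩ʳ (α h) ≡ α′ (φ ⟨$⟩ʳ h))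
  (φ-σ̄ : ∀ h → φ ⟨$⟩ʳ (σ̄ h) ≡ σ̄′ (φ ⟨$⟩ʳ h)) where

  private
    module M  = Marked α σ̄ r
    module M′ = Marked α′ σ̄′ r′

    φ-inj : ∀ {x y} → φ ⟨$⟩ʳ x ≡ φ ⟨$⟩ʳ y → x ≡ y
    φ-inj = perm-injective φ

    φ-tour : ∀ k → φ ⟨$⟩ʳ iter (λ h → α (σ̄ h)) k r ≡ iter (λ h → α′ (σ̄′ h)) k r′
    φ-tour k = trans (iter-conj _ _ (φ ⟨$⟩ʳ_) (λ h → trans (φ-α (σ̄ h)) (cong α′ (φ-σ̄ h))) k r)
                     (cong (iter (λ h → α′ (σ̄′ h)) k) φ-root)

    φ-cycle : ∀ j x → φ ⟨$⟩ʳ iter σ̄ j x ≡ iter σ̄′ j (φ ⟨$⟩ʳ x)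
    φ-cycle = iter-conj σ̄ σ̄′ (φ ⟨$⟩ʳ_) φ-σ̄

    at-to : ∀ {k x} → M.At k x → M′.At k (φ ⟨$⟩ʳ x)
    at-to {k} (k<N , e) = k<N , trans (sym (φ-tour k)) (cong (φ ⟨$⟩ʳ_) e)

    at-from : ∀ {k x} → M′.At k (φ ⟨$⟩ʳ x) → M.At k x
    at-from {k} (k<N , e) = k<N , φ-inj (trans (φ-tour k) e)

    earliest-transport : ∀ {Q Q′ k x} → (∀ {k x} → Q k x → Q′ k (φ ⟨$⟩ʳ x))
                       → (∀ {k x} → Q′ k (φ ⟨$⟩ʳ x) → Q k x)
                       → M.EarliestAt Q k x → M′.EarliestAt Q′ k (φ ⟨$⟩ʳ x)
    earliest-transport {Q} {Q′} {k} to from (at , q , first) = at-to at , to q , first′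
      where
      -- a half-edge y′ at position k′ of the image tour is the image of position k′
      first′ : ∀ k′ y′ → M′.At k′ y′ → Q′ k′ y′ → k ≤ k′
      first′ k′ _ (k′<N , refl) q′ = first k′ _ (k′<N , refl) (from (subst (Q′ k′) (sym (φ-tour k′)) q′))

    module _ {b b′ : Fin N} (φb : φ ⟨$⟩ʳ b ≡ b′) where

      first-key-to : ∀ {k x} → M.FirstKey b k x → M′.FirstKey b′ k (φ ⟨$⟩ʳ x)
      first-key-to {x = x} (j , e) = j , trans (sym (φ-cycle j x)) (trans (cong (φ ⟨$⟩ʳ_) e) φb)

      first-key-from : ∀ {k x} → M′.FirstKey b′ k (φ ⟨$⟩ʳ x) → M.FirstKey b k x
      first-key-from {x = x} (j , e) = j , φ-inj (trans (φ-cycle j x) (trans e (sym φb)))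

      module _ {a a′ : Fin N} (φa : φ ⟨$⟩ʳ a ≡ a′) where

        φ-arc : ∀ i → φ ⟨$⟩ʳ iter σ̄ i a ≡ iter σ̄′ i a′
        φ-arc i = trans (φ-cycle i a) (cong (iter σ̄′ i) φa)

        second-key-to : ∀ {k x} → M.SecondKey a b k x → M′.SecondKey a′ b′ k (φ ⟨$⟩ʳ x)
        second-key-to ((j , e , avoid) , k₀ , at₀ , k₀<k) =
          (j , trans (sym (φ-arc (suc j))) (cong (φ ⟨$⟩ʳ_) e)
             , λ i i≤ e′ → avoid i i≤ (φ-inj (trans (φ-arc i) (trans e′ (sym φb)))))
          , k₀ , subst (M′.At k₀) φb (at-to at₀) , k₀<k

        second-key-from : ∀ {k x} → M′.SecondKey a′ b′ k (φ ⟨$⟩ʳ x) → M.SecondKey a b k x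
        second-key-from ((j , e′ , avoid′) , k₀ , at₀′ , k₀<k) =
          (j , φ-inj (trans (φ-arc (suc j)) e′)
             , λ i i≤ e → avoid′ i i≤ (trans (sym (φ-arc i)) (trans (cong (φ ⟨$⟩ʳ_) e) φb)))
          , k₀ , at-from (subst (M′.At k₀) (sym φb) at₀′) , k₀<k

  first-preserved : ∀ {b b′ k k′ x x′} → φ ⟨$⟩ʳ b ≡ b′
                  → M.EarliestAt (M.FirstKey b) k x → M′.EarliestAt (M′.FirstKey b′) k′ x′
                  → φ ⟨$⟩ʳ x ≡ x′
  first-preserved {b} {b′} φb e e′ = M′.earliest-unique
    (earliest-transport {M.FirstKey b} {M′.FirstKey b′} (λ {k} → first-key-to φb {k}) (λ {k} → first-key-from φb {k}) e) e′

  second-preserved : ∀ {a a′ b b′ k k′ x x′} → φ ⟨$⟩ʳ a ≡ a′ → φ ⟨$⟩ʳ b ≡ b′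
                   → M.EarliestAt (M.SecondKey a b) k x → M′.EarliestAt (M′.SecondKey a′ b′) k′ x′
                   → φ ⟨$⟩ʳ x ≡ x′
  second-preserved {a} {a′} {b} {b′} φa φb e e′ = M′.earliest-unique
    (earliest-transport {M.SecondKey a b} {M′.SecondKey a′ b′} (second-key-to φb φa) (second-key-from φb φa) e) e′

module Gluing {n : ℕ} (m : UMap n) (a : Fin 3 → H m)
  (a-distinct : ∀ i j → SameVertex m (a i) (a j) → i ≡ j)
  (a-min : ∀ i x → SameVertex m (a i) x → x ≡ a i ⊎ _<ₘ_ m (a i) x)
  (a₁<a₂ : _<ₘ_ m (a 0F) (a 1F)) (a₂<a₃ : _<ₘ_ m (a 1F) (a 2F))
  (σ̄ : H m → H m) (σ̄-glue : ∀ h → σ̄ h ≡ glue σ⟨ m ⟩ (a 0F) (a 1F) (a 2F) h) where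

  open Marked α⟨ m ⟩ σ̄ (UMap.root m)

  N : ℕ
  N = 2 * n

  r : H m
  r = UMap.root m

  σₘ γₘ γ̄ : H m → H m
  σₘ = σ⟨ m ⟩
  γₘ = γ m
  γ̄ h = α⟨ m ⟩ (σ̄ h)

  a₁ a₂ a₃ : H m
  a₁ = a 0F
  a₂ = a 1F
  a₃ = a 2F

  open Dynamics σₘ (perm-injective (UMap.σ m)) using (first-return)
  open Dynamics γₘ (λ e → perm-injective (UMap.σ m) (perm-injective (UMap.α m) e)) using (module Transitive)
  open Transitive r (UMap.γ-one-cycle m r)

  a-injective : ∀ {i j} → a i ≡ a j → i ≡ j
  a-injective {i} e = a-distinct i _ (subst (SameVertex m (a i)) e (vertex-refl m (a i)))

  a₂≢a₁ : a₂ ≢ a₁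
  a₂≢a₁ e with a-injective e
  ... | ()

  a₃≢a₁ : a₃ ≢ a₁
  a₃≢a₁ e with a-injective e
  ... | ()

  a₃≢a₂ : a₃ ≢ a₂
  a₃≢a₂ e with a-injective e
  ... | ()

  Unglued : H m → Set
  Unglued x = ∀ l → x ≢ a l

  σ̄-unglued : ∀ {x} → Unglued x → σ̄ x ≡ σₘ x
  σ̄-unglued u = trans (σ̄-glue _) (glue-elsewhere σₘ a₁ a₂ a₃ _ (u 0F) (u 1F) (u 2F))

  σ̄-a₁ : σ̄ a₁ ≡ σₘ a₂
  σ̄-a₁ = trans (σ̄-glue a₁) (glue-at₁ σₘ a₁ a₂ a₃)

  σ̄-a₂ : σ̄ a₂ ≡ σₘ a₃
  σ̄-a₂ = trans (σ̄-glue a₂) (glue-at₂ σₘ a₁ a₂ a₃ a₂≢a₁)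

  σ̄-a₃ : σ̄ a₃ ≡ σₘ a₁
  σ̄-a₃ = trans (σ̄-glue a₃) (glue-at₃ σₘ a₁ a₂ a₃ a₃≢a₁ a₃≢a₂)

  unglued-on-vertex : ∀ l {x} → SameVertex m (a l) x → x ≢ a l → Unglued x
  unglued-on-vertex l s x≢al l′ e with l′ ≟ l
  ... | yes refl  = x≢al e
  ... | no l′≢l   = l′≢l (sym (a-distinct l l′ (subst (SameVertex m (a l)) e s)))

  γ̄-unglued : ∀ {x} → Unglued x → γ̄ x ≡ γₘ x
  γ̄-unglued u = cong α⟨ m ⟩ (σ̄-unglued u)

  record Positions : Set where
    field
      p₁ s t : ℕ
      at-a₁ : iter γₘ p₁ r ≡ a₁
      at-a₂ : iter γₘ (suc s + p₁) r ≡ a₂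
      at-a₃ : iter γₘ (suc t + (suc s + p₁)) r ≡ a₃
      a₃<N  : suc t + (suc s + p₁) < N

  positions-from : _<ₘ_ m a₁ a₂ → _<ₘ_ m a₂ a₃ → Positions
  positions-from (k₀ , k₁ , k₀<k₁ , k₁<N , e₀ , e₁) (l₀ , l₁ , l₀<l₁ , l₁<N , f₀ , f₁)
    with offset k₀<k₁ | offset l₀<l₁ | position-unique k₁<N (<-trans l₀<l₁ l₁<N) (trans e₁ (sym f₀))
  ... | s , refl | t , refl | refl =
    record { p₁ = k₀ ; s = s ; t = t ; at-a₁ = e₀ ; at-a₂ = e₁ ; at-a₃ = f₁ ; a₃<N = l₁<N }

  open Positions (positions-from a₁<a₂ a₂<a₃)

  -- p₁ < p₂ < p₃ are the γ-positions of a₁, a₂, a₃; in the tour of γ̄, a₃ sits at q₃.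
  p₂ p₃ q₃ : ℕ
  p₂ = suc s + p₁
  p₃ = suc t + p₂
  q₃ = suc t + p₁

  p₁<p₂ : p₁ < p₂
  p₁<p₂ = s≤s (m≤n+m p₁ s)

  p₂<p₃ : p₂ < p₃
  p₂<p₃ = s≤s (m≤n+m p₂ t)

  p₁<q₃ : p₁ < q₃
  p₁<q₃ = s≤s (m≤n+m p₁ t)

  q₃<p₃ : q₃ < p₃
  q₃<p₃ = +-monoʳ-< (suc t) p₁<p₂

  p₃≡ : p₃ ≡ suc s + q₃
  p₃≡ = x∙yz≈y∙xz +-commutativeSemigroup (suc t) (suc s) p₁

  p₃<N : p₃ < N
  p₃<N = a₃<N

  q₃<N : q₃ < N
  q₃<N = <-trans q₃<p₃ p₃<N

  P : Fin 3 → ℕ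
  P 0F = p₁
  P 1F = p₂
  P 2F = p₃

  at-P : ∀ l → iter γₘ (P l) r ≡ a l
  at-P 0F = at-a₁
  at-P 1F = at-a₂
  at-P 2F = at-a₃

  p₁≤P : ∀ l → p₁ ≤ P l
  p₁≤P 0F = ≤-refl
  p₁≤P 1F = <⇒≤ p₁<p₂
  p₁≤P 2F = <⇒≤ (<-trans p₁<p₂ p₂<p₃)

  P<N : ∀ l → P l < N
  P<N l = ≤-<-trans (P≤p₃ l) p₃<N
    where
    P≤p₃ : ∀ l → P l ≤ p₃
    P≤p₃ 0F = <⇒≤ (<-trans p₁<p₂ p₂<p₃)
    P≤p₃ 1F = <⇒≤ p₂<p₃
    P≤p₃ 2F = ≤-refl

  position-of : ∀ {q l} → q < N → iter γₘ q r ≡ a l → q ≡ P l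
  position-of {l = l} q<N e = position-unique q<N (P<N l) (trans e (sym (at-P l)))

  unglued-at : ∀ {q} → q < N → (∀ l → q ≢ P l) → Unglued (iter γₘ q r)
  unglued-at q<N q≢P l e = q≢P l (position-of q<N e)

  unglued-before-a₁ : ∀ j → j < p₁ → Unglued (iter γₘ j r)
  unglued-before-a₁ j j<p₁ = unglued-at (<-trans j<p₁ (P<N 0F)) λ l → <⇒≢ (<-≤-trans j<p₁ (p₁≤P l))

  unglued-a₁-to-a₂ : ∀ j → j < s → Unglued (iter γₘ (suc j + p₁) r)
  unglued-a₁-to-a₂ j j<s = unglued-at (<-trans q<p₂ (P<N 1F))
    λ { 0F → >⇒≢ (s≤s (m≤n+m p₁ j)) ; 1F → <⇒≢ q<p₂ ; 2F → <⇒≢ (<-trans q<p₂ p₂<p₃) }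
    where
    q<p₂ : suc j + p₁ < p₂
    q<p₂ = +-monoˡ-< p₁ (s≤s j<s)

  unglued-a₂-to-a₃ : ∀ j → j < t → Unglued (iter γₘ (suc j + p₂) r)
  unglued-a₂-to-a₃ j j<t = unglued-at (<-trans q<p₃ p₃<N)
    λ { 0F → >⇒≢ (<-trans p₁<p₂ p₂<q) ; 1F → >⇒≢ p₂<q ; 2F → <⇒≢ q<p₃ }
    where
    p₂<q : p₂ < suc j + p₂
    p₂<q = s≤s (m≤n+m p₂ j)
    q<p₃ : suc j + p₂ < p₃
    q<p₃ = +-monoˡ-< p₂ (s≤s j<t)

  unglued-after-a₃ : ∀ j → suc j + p₃ < N → Unglued (iter γₘ (suc j + p₃) r)
  unglued-after-a₃ j q<N = unglued-at q<N
    λ { 0F → >⇒≢ (<-trans (<-trans p₁<p₂ p₂<p₃) p₃<q) ; 1F → >⇒≢ (<-trans p₂<p₃ p₃<q) ; 2F → >⇒≢ p₃<q }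
    where
    p₃<q : p₃ < suc j + p₃
    p₃<q = s≤s (m≤n+m p₃ j)

  follow : ∀ {k x} p i → iter γ̄ k r ≡ x → γ̄ x ≡ γₘ (iter γₘ p r)
         → (∀ j → j < i → Unglued (iter γₘ (suc j + p) r))
         → iter γ̄ (suc i + k) r ≡ iter γₘ (suc i + p) r
  follow {k} {x} p i at-x step unglued = begin
    iter γ̄ (suc i + k) r          ≡⟨ iter-after γ̄ i k r ⟩
    iter γ̄ i (γ̄ (iter γ̄ k r))    ≡⟨ cong (λ y → iter γ̄ i (γ̄ y)) at-x ⟩
    iter γ̄ i (γ̄ x)                ≡⟨ cong (iter γ̄ i) step ⟩
    iter γ̄ i (γₘ (iter γₘ p r))    ≡⟨ iter-follow γ̄ γₘ i _ agree ⟩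
    iter γₘ i (γₘ (iter γₘ p r))   ≡⟨ sym (iter-after γₘ i p r) ⟩
    iter γₘ (suc i + p) r          ∎
    where
    open ≡-Reasoning
    agree : ∀ j → j < i → γ̄ (iter γₘ j (γₘ (iter γₘ p r))) ≡ γₘ (iter γₘ j (γₘ (iter γₘ p r)))
    agree j j<i = γ̄-unglued (subst Unglued (iter-after γₘ j p r) (unglued j j<i))

  -- The four stretches of the γ̄-tour: up to a₁ as in γ; then from the successor
  -- of a₂ up to a₃; then from the successor of a₁ up to a₂; then on as in γ.
  tour-start : ∀ k → k ≤ p₁ → iter γ̄ k r ≡ iter γₘ k r
  tour-start k k≤p₁ = iter-follow γ̄ γₘ k r λ j j<k → γ̄-unglued (unglued-before-a₁ j (<-≤-trans j<k k≤p₁))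

  tour-a₁ : iter γ̄ p₁ r ≡ a₁
  tour-a₁ = trans (tour-start p₁ ≤-refl) at-a₁

  tour-second : ∀ i → i ≤ t → iter γ̄ (suc i + p₁) r ≡ iter γₘ (suc i + p₂) r
  tour-second i i≤t = follow p₂ i tour-a₁ (trans (cong α⟨ m ⟩ σ̄-a₁) (cong γₘ (sym at-a₂)))
                        λ j j<i → unglued-a₂-to-a₃ j (<-≤-trans j<i i≤t)

  tour-a₃ : iter γ̄ q₃ r ≡ a₃
  tour-a₃ = trans (tour-second t ≤-refl) at-a₃

  tour-third : ∀ i → i ≤ s → iter γ̄ (suc i + q₃) r ≡ iter γₘ (suc i + p₁) r
  tour-third i i≤s = follow p₁ i tour-a₃ (trans (cong α⟨ m ⟩ σ̄-a₃) (cong γₘ (sym at-a₁)))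
                       λ j j<i → unglued-a₁-to-a₂ j (<-≤-trans j<i i≤s)

  tour-a₂ : iter γ̄ p₃ r ≡ a₂
  tour-a₂ = trans (cong (λ k → iter γ̄ k r) p₃≡) (trans (tour-third s ≤-refl) at-a₂)

  tour-end : ∀ i → suc i + p₃ < N → iter γ̄ (suc i + p₃) r ≡ iter γₘ (suc i + p₃) r
  tour-end i k<N = follow p₃ i tour-a₂ (trans (cong α⟨ m ⟩ σ̄-a₂) (cong γₘ (sym at-a₃)))
                     λ j j<i → unglued-after-a₃ j (<-trans (+-monoˡ-< p₃ (s≤s j<i)) k<N)

  data Stretch : ℕ → Set where
    first  : ∀ {k} → k ≤ p₁ → Stretch k
    second : ∀ i → i ≤ t → Stretch (suc i + p₁)
    third  : ∀ i → i ≤ s → Stretch (suc i + q₃)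
    last   : ∀ i → Stretch (suc i + p₃)

  private
    in-second : ∀ {k} → (∃ λ i → k ≡ suc i + p₁) → k ≤ q₃ → Stretch k
    in-second (i , refl) k≤q₃ = second i (s≤s⁻¹ (+-cancelʳ-≤ p₁ (suc i) (suc t) k≤q₃))

    in-third : ∀ {k} → (∃ λ i → k ≡ suc i + q₃) → k ≤ p₃ → Stretch k
    in-third (i , refl) k≤p₃ = third i (s≤s⁻¹ (+-cancelʳ-≤ q₃ (suc i) (suc s) (subst (suc i + q₃ ≤_) p₃≡ k≤p₃)))

    in-last : ∀ {k} → (∃ λ i → k ≡ suc i + p₃) → Stretch k
    in-last (i , refl) = last i

  stretch : ∀ k → Stretch k
  stretch k with k ≤? p₁ | k ≤? q₃ | k ≤? p₃
  ... | yes k≤p₁ | _        | _        = first k≤p₁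
  ... | no k≰p₁  | yes k≤q₃ | _        = in-second (offset (≰⇒> k≰p₁)) k≤q₃
  ... | no _     | no k≰q₃  | yes k≤p₃ = in-third (offset (≰⇒> k≰q₃)) k≤p₃
  ... | no _     | no _     | no k≰p₃  = in-last (offset (≰⇒> k≰p₃))

  a₃-only-at-q₃ : ∀ k → k < N → iter γ̄ k r ≡ a₃ → k ≡ q₃
  a₃-only-at-q₃ k k<N e with stretch k
  ... | first k≤p₁ =
    contradiction (position-of k<N (trans (sym (tour-start k k≤p₁)) e)) (<⇒≢ (≤-<-trans k≤p₁ (<-trans p₁<p₂ p₂<p₃)))
  ... | second i i≤t = cong (λ j → suc j + p₁) (suc-injective (+-cancelʳ-≡ p₂ (suc i) (suc t)
          (position-of (≤-<-trans (+-monoˡ-≤ p₂ (s≤s i≤t)) p₃<N) (trans (sym (tour-second i i≤t)) e))))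
  ... | third i i≤s =
    contradiction (position-of (<-trans (≤-<-trans i+p₁≤p₂ p₂<p₃) p₃<N) (trans (sym (tour-third i i≤s)) e))
                  (<⇒≢ (≤-<-trans i+p₁≤p₂ p₂<p₃))
    where
    i+p₁≤p₂ : suc i + p₁ ≤ p₂
    i+p₁≤p₂ = +-monoˡ-≤ p₁ (s≤s i≤s)
  ... | last i =
    contradiction (position-of k<N (trans (sym (tour-end i k<N)) e)) (>⇒≢ (s≤s (m≤n+m p₃ i)))

  -- After q₃, a half-edge at γ-position at least p₂ cannot appear before p₃:
  -- the third stretch only runs through γ-positions between p₁ and p₂.
  after-q₃ : ∀ k e → q₃ < k → k < N → e < N → p₂ ≤ e → iter γ̄ k r ≡ iter γₘ e r → p₃ ≤ k
  after-q₃ k e q₃<k k<N e<N p₂≤e same with stretch k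
  ... | first k≤p₁   = contradiction (<-≤-trans q₃<k k≤p₁) (<-asym p₁<q₃)
  ... | second i i≤t = contradiction q₃<k (≤⇒≯ (+-monoˡ-≤ p₁ (s≤s i≤t)))
  ... | last i       = m≤n+m p₃ (suc i)
  ... | third i i≤s with m≤n⇒m<n∨m≡n i≤s
  ...   | inj₂ refl = ≤-reflexive p₃≡
  ...   | inj₁ i<s  = contradiction p₂≤e (<⇒≱ (subst (_< p₂) e≡ (+-monoˡ-< p₁ (s≤s i<s))))
    where
    e≡ : suc i + p₁ ≡ e
    e≡ = position-unique (<-trans (+-monoˡ-< p₁ (s≤s i<s)) (P<N 1F)) e<N (trans (sym (tour-third i i≤s)) same)

  vertex-min : ∀ l {x} e → SameVertex m (a l) x → e < N → iter γₘ e r ≡ x → P l ≤ e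
  vertex-min l e s e<N at-e with a-min l _ s
  ... | inj₁ refl = ≤-reflexive (sym (position-of e<N at-e))
  ... | inj₂ (j₀ , j₁ , j₀<j₁ , j₁<N , at-j₀ , at-j₁) =
    subst₂ _≤_ (position-of (<-trans j₀<j₁ j₁<N) at-j₀)
               (position-unique j₁<N e<N (trans at-j₁ (sym at-e))) (<⇒≤ j₀<j₁)

  OnGluedVertex : H m → Set
  OnGluedVertex x = ∃ λ l → SameVertex m (a l) x

  off-glued-step : ∀ {y} → ¬ OnGluedVertex y → ¬ OnGluedVertex (σ̄ y)
  off-glued-step {y} off (l , s) =
    off (l , vertex-trans m (subst (SameVertex m (a l)) (σ̄-unglued unglued) s) (vertex-sym m (vertex-step m y)))
    where
    unglued : Unglued y
    unglued l′ refl = off (l′ , vertex-refl m _)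

  off-glued-iter : ∀ j {y} → ¬ OnGluedVertex y → ¬ OnGluedVertex (iter σ̄ j y)
  off-glued-iter zero    off = off
  off-glued-iter (suc j) off = off-glued-step (off-glued-iter j off)

  -- Leaving a l through σ̄, the σ̄-cycle runs once around the vertex of a l:
  -- it follows σ from σ (a l) until σ returns to a l.
  walk-vertex : ∀ l {x} → σ̄ x ≡ σₘ (a l)
              → ∃ λ c → iter σ̄ c (σ̄ x) ≡ a l × (∀ j → j ≤ c → SameVertex m (a l) (iter σ̄ j (σ̄ x)))
  walk-vertex l {x} step with first-return (a l)
  ... | c , returns , early = c , trans (along c ≤-refl) returns , on-vertex
    where
    around : ∀ j → SameVertex m (a l) (iter σₘ j (σₘ (a l)))
    around j = suc j , iter-suc σₘ j (a l)
    along : ∀ j → j ≤ c → iter σ̄ j (σ̄ x) ≡ iter σₘ j (σₘ (a l))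
    along j j≤c = trans (cong (iter σ̄ j) step) (iter-follow σ̄ σₘ j _
      λ i i<j → σ̄-unglued (unglued-on-vertex l (around i) (early i (<-≤-trans i<j j≤c))))
    on-vertex : ∀ j → j ≤ c → SameVertex m (a l) (iter σ̄ j (σ̄ x))
    on-vertex j j≤c = subst (SameVertex m (a l)) (sym (along j j≤c)) (around j)

  a₁-to-a₂ : ∃ λ c → iter σ̄ (suc c) a₁ ≡ a₂ × (∀ i → i ≤ suc c → iter σ̄ i a₁ ≢ a₃)
  a₁-to-a₂ with walk-vertex 1F σ̄-a₁
  ... | c , returns , on-vertex = c , trans (iter-suc σ̄ c a₁) returns , avoid
    where
    avoid : ∀ i → i ≤ suc c → iter σ̄ i a₁ ≢ a₃
    avoid zero    _         e = a₃≢a₁ (sym e)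
    avoid (suc j) (s≤s j≤c) e
      with a-distinct 1F 2F (subst (SameVertex m a₂) (trans (sym (iter-suc σ̄ j a₁)) e) (on-vertex j j≤c))
    ... | ()

  a₁-to-a₃ : ∃ λ j → iter σ̄ j a₁ ≡ a₃
  a₁-to-a₃ with a₁-to-a₂ | walk-vertex 2F σ̄-a₂
  ... | c₂ , at-a₂′ , _ | c₃ , returns , _ = suc c₃ + suc c₂ , (begin
    iter σ̄ (suc c₃ + suc c₂) a₁           ≡⟨ iter-add σ̄ (suc c₃) (suc c₂) a₁ ⟩
    iter σ̄ (suc c₃) (iter σ̄ (suc c₂) a₁)  ≡⟨ cong (iter σ̄ (suc c₃)) at-a₂′ ⟩
    iter σ̄ (suc c₃) a₂                     ≡⟨ iter-suc σ̄ c₃ a₂ ⟩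
    iter σ̄ c₃ (σ̄ a₂)                       ≡⟨ returns ⟩
    a₃                                      ∎)
    where open ≡-Reasoning

  OnArcVertices : H m → Set
  OnArcVertices x = SameVertex m a₂ x ⊎ SameVertex m a₃ x

  arc-not-a₁ : ∀ {x} → OnArcVertices x → x ≢ a₁
  arc-not-a₁ (inj₁ s) refl with a-distinct 1F 0F s
  ... | ()
  arc-not-a₁ (inj₂ s) refl with a-distinct 2F 0F s
  ... | ()

  arc-step : ∀ x → x ≢ a₃ → OnArcVertices x → OnArcVertices (σ̄ x)
  arc-step x x≢a₃ on with x ≟ a₂
  ... | yes refl = inj₂ (subst (SameVertex m a₃) (sym σ̄-a₂) (vertex-step m a₃))
  ... | no x≢a₂  = Sum.map (λ s → vertex-trans m s moves) (λ s → vertex-trans m s moves) on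
    where
    moves : SameVertex m x (σ̄ x)
    moves = subst (SameVertex m x) (sym (σ̄-unglued λ { 0F → arc-not-a₁ on ; 1F → x≢a₂ ; 2F → x≢a₃ }))
                  (vertex-step m x)

  arc-vertices : ∀ j → (∀ i → i ≤ suc j → iter σ̄ i a₁ ≢ a₃) → OnArcVertices (iter σ̄ (suc j) a₁)
  arc-vertices zero    _     = inj₁ (subst (SameVertex m a₂) (sym σ̄-a₁) (vertex-step m a₂))
  arc-vertices (suc j) avoid =
    arc-step _ (avoid (suc j) (n≤1+n (suc j))) (arc-vertices j λ i i≤ → avoid i (m≤n⇒m≤1+n i≤))

  -- a₁ is the first half-edge of the γ̄-tour whose σ̄-cycle contains a₃: every such
  -- half-edge lies on a glued vertex, and those do not occur before a₁.
  a₁-earliest : EarliestAt (FirstKey a₃) p₁ a₁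
  a₁-earliest = (P<N 0F , tour-a₁) , a₁-to-a₃ , not-before
    where
    not-before : ∀ k y → At k y → FirstKey a₃ k y → p₁ ≤ k
    not-before k y (k<N , at-y) (j , reaches) = ≮⇒≥ λ k<p₁ →
      off-glued-iter j (off k<p₁) (2F , subst (SameVertex m a₃) (sym reaches) (vertex-refl m a₃))
      where
      off : k < p₁ → ¬ OnGluedVertex y
      off k<p₁ (l , s) = <⇒≱ (<-≤-trans k<p₁ (p₁≤P l))
                               (vertex-min l k s k<N (trans (sym (tour-start k (<⇒≤ k<p₁))) at-y))

  -- a₂ is the first half-edge of the γ̄-tour after a₃ lying strictly between a₁ and
  -- a₃ on their σ̄-cycle: such half-edges have γ-position at least p₂.
  a₂-earliest : EarliestAt (SecondKey a₁ a₃) p₃ a₂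
  a₂-earliest = (p₃<N , tour-a₂) , (a₁-to-a₂ , q₃ , (q₃<N , tour-a₃) , q₃<p₃) , not-before
    where
    not-before : ∀ k y → At k y → SecondKey a₁ a₃ k y → p₃ ≤ k
    not-before k y (k<N , at-y) ((j , arc , avoid) , k₀ , (k₀<N , at-k₀) , k₀<k) with position-exists y
    ... | e , e<N , at-e = after-q₃ k e q₃<k k<N e<N p₂≤e (trans at-y (sym at-e))
      where
      q₃<k : q₃ < k
      q₃<k = subst (_< k) (a₃-only-at-q₃ k₀ k₀<N at-k₀) k₀<k
      p₂≤e : p₂ ≤ e
      p₂≤e with arc-vertices j avoid
      ... | inj₁ s = vertex-min 1F e (subst (SameVertex m a₂) arc s) e<N at-e
      ... | inj₂ s = ≤-trans (<⇒≤ p₂<p₃) (vertex-min 2F e (subst (SameVertex m a₃) arc s) e<N at-e)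

module _ {n} (m : UMap n) (v : Fin 3 → H m) (π : Permutation′ 3) (a : Fin 3 → H m)
         (mins : ∀ i → IsMinOfVertex m (v (π ⟨$⟩ʳ i)) (a i)) where

  phi-distinct : DistinctVertices m v → ∀ i j → SameVertex m (a i) (a j) → i ≡ j
  phi-distinct dv i j s =
    perm-injective π (dv _ _ (vertex-trans m (vertex-trans m (proj₁ (mins i)) s) (vertex-sym m (proj₁ (mins j)))))

  phi-min : ∀ i x → SameVertex m (a i) x → x ≡ a i ⊎ _<ₘ_ m (a i) x
  phi-min i x s = proj₂ (mins i) x (vertex-trans m (proj₁ (mins i)) s)

-- A relabelling that conjugates σ and carries each gluing point to its counterpart
-- matches the vertices of v with those of v′, both being the vertices of the a's.
vertices-match : ∀ {n} (m m′ : UMap n) (v : Fin 3 → H m) (v′ : Fin 3 → H m′) (π π′ : Permutation′ 3)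
                 {a : Fin 3 → H m} {a′ : Fin 3 → H m′}
               → (∀ i → IsMinOfVertex m (v (π ⟨$⟩ʳ i)) (a i))
               → (∀ i → IsMinOfVertex m′ (v′ (π′ ⟨$⟩ʳ i)) (a′ i))
               → (φ : H m → H m′) → (∀ h → φ (σ⟨ m ⟩ h) ≡ σ⟨ m′ ⟩ (φ h)) → (∀ l → φ (a l) ≡ a′ l)
               → (∀ i → ∃ λ j → SameVertex m′ (φ (v i)) (v′ j))
               × (∀ j → ∃ λ i → SameVertex m′ (φ (v i)) (v′ j))
vertices-match m m′ v v′ π π′ mins mins′ φ φ-σ φ-a =
    (λ i → π′ ⟨$⟩ʳ (π ⟨$⟩ˡ i) , subst (λ i′ → SameVertex m′ (φ (v i′)) (v′ (π′ ⟨$⟩ʳ (π ⟨$⟩ˡ i)))) (inverseʳ π) (image (π ⟨$⟩ˡ i)))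
  , (λ j → π ⟨$⟩ʳ (π′ ⟨$⟩ˡ j) , subst (λ j′ → SameVertex m′ (φ (v (π ⟨$⟩ʳ (π′ ⟨$⟩ˡ j)))) (v′ j′)) (inverseʳ π′) (image (π′ ⟨$⟩ˡ j)))
  where
  image : ∀ l → SameVertex m′ (φ (v (π ⟨$⟩ʳ l))) (v′ (π′ ⟨$⟩ʳ l))
  image l = vertex-trans m′ (subst (SameVertex m′ _) (φ-a l) (vertex-transport m m′ φ φ-σ (proj₁ (mins l))))
                            (vertex-sym m′ (proj₁ (mins′ l)))

lemma5 : ∀ {n : ℕ} (m m' : UMap n) (v : Fin 3 → H m) (v' : Fin 3 → H m')
    → DistinctVertices m v → DistinctVertices m' v'
    → (σ̄ σ̄' : H m → H m) (τ τ' : H m)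
    → PhiGraph m v σ̄ τ → PhiGraph m' v' σ̄' τ'
    → IsoMarked (UMap.α m ⟨$⟩ʳ_) σ̄ (UMap.root m) τ (UMap.α m' ⟨$⟩ʳ_) σ̄' (UMap.root m') τ'
    → IsoWithVertices m m' v v'
lemma5 m m′ v v′ dv dv′ σ̄ σ̄′ τ τ′
       (π , a , mins , a₁<a₂ , a₂<a₃ , σ̄-glue , σ̄τ)
       (π′ , a′ , mins′ , a₁<a₂′ , a₂<a₃′ , σ̄-glue′ , σ̄τ′)
       (φ , φ-root , φ-α , φ-σ̄ , φ-τ) =
  φ , φ-root , φ-α , φ-σ , vertices-match m m′ v v′ π π′ mins mins′ (φ ⟨$⟩ʳ_) φ-σ φ-a
  where
  module G  = Gluing m a (phi-distinct m v π a mins dv) (phi-min m v π a mins) a₁<a₂ a₂<a₃ σ̄ σ̄-glue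
  module G′ = Gluing m′ a′ (phi-distinct m′ v′ π′ a′ mins′ dv′) (phi-min m′ v′ π′ a′ mins′)
                     a₁<a₂′ a₂<a₃′ σ̄′ σ̄-glue′
  open MarkedIso {α = α⟨ m ⟩} {σ̄} {α⟨ m′ ⟩} {σ̄′} φ φ-root φ-α φ-σ̄

  φ-a₃ : φ ⟨$⟩ʳ a 2F ≡ a′ 2F
  φ-a₃ = trans (cong (φ ⟨$⟩ʳ_) (sym σ̄τ)) (trans (φ-σ̄ τ) (trans (cong σ̄′ φ-τ) σ̄τ′))

  φ-a₁ : φ ⟨$⟩ʳ a 0F ≡ a′ 0F
  φ-a₁ = first-preserved φ-a₃ G.a₁-earliest G′.a₁-earliest

  φ-a₂ : φ ⟨$⟩ʳ a 1F ≡ a′ 1F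
  φ-a₂ = second-preserved φ-a₁ φ-a₃ G.a₂-earliest G′.a₂-earliest

  φ-a : ∀ l → φ ⟨$⟩ʳ a l ≡ a′ l
  φ-a 0F = φ-a₁
  φ-a 1F = φ-a₂
  φ-a 2F = φ-a₃

  φ-σ : ∀ h → φ ⟨$⟩ʳ σ⟨ m ⟩ h ≡ σ⟨ m′ ⟩ (φ ⟨$⟩ʳ h)
  φ-σ = Unglue.unglue-conj (φ ⟨$⟩ʳ_) (perm-injective φ) σ⟨ m ⟩ σ⟨ m′ ⟩ G.a₂≢a₁ G.a₃≢a₁ G.a₃≢a₂ φ-a₁ φ-a₂ φ-a₃
          λ h → trans (cong (φ ⟨$⟩ʳ_) (sym (σ̄-glue h))) (trans (φ-σ̄ h) (σ̄-glue′ (φ ⟨$⟩ʳ h)))
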